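{- Let $i,j$ be positive integers and $D$ an $(i,j)$ digraph. If $P(D)$ contains an induced subgraph $H$ isomorphic to $K_{1,j+1}$ with center $v$ (the vertex of degree $j+1$ in $H$), then $|N^-_D(v)\cap V(H)| = 1$.
   Context: An $(i,j)$ digraph is an acyclic digraph in which every vertex has indegree at most $i$ and outdegree at most $j$. The phylogeny graph $P(D)$ has vertex set $V(D)$ and an edge between distinct $u,v$ iff $(u,v)\in A(D)$ or $(v,u)\in A(D)$ or $u,v$ have a common out-neighbor in $D$. $N^-_D(v)$ denotes the set of in-neighbors of $v$ in $D$. -}

module Defs where

open import Data.Nat using (ℕ; zero; suc; _+_; _≤_)
open import Data.Bool using (Bool; true; false; T)
open import Data.Fin using (Fin)
open import Data.List using (List; _∷_; map)
open import Data.Nat.ListAction using () renaming (sum to lsum)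
open import Data.Product using (_×_; ∃-syntax)
open import Data.Sum using (_⊎_)
open import Relation.Binary.PropositionalEquality using (_≡_; _≢_)
open import Relation.Binary.Construct.Closure.Transitive using (TransClosure)
open import Relation.Nullary using (¬_)
open import Function.Definitions using (Injective)

record Digraph (n : ℕ) : Set where
  field
    arc : Fin n → Fin n → Bool

open Digraph public

Arc : ∀ {n} → Digraph n → Fin n → Fin n → Set
Arc D u w = T (arc D u w)

verts : (n : ℕ) → List (Fin n)
verts n = Data.List.allFin n

b2n : Bool → ℕ
b2n true = 1
b2n false = 0

countL : ∀ {n} → (Fin n → Bool) → List (Fin n) → ℕ
countL p xs = lsum (map (λ x → b2n (p x)) xs)

indeg : ∀ {n} → Digraph n → Fin n → ℕ
indeg {n} D v = countL (λ u → arc D u v) (verts n)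

outdeg : ∀ {n} → Digraph n → Fin n → ℕ
outdeg {n} D v = countL (λ w → arc D v w) (verts n)

Acyclic : ∀ {n} → Digraph n → Set
Acyclic D = ∀ v → ¬ TransClosure (Arc D) v v

IsIJDigraph : ℕ → ℕ → ∀ {n} → Digraph n → Set
IsIJDigraph i j {n} D =
  Acyclic D × (∀ v → indeg D v ≤ i) × (∀ v → outdeg D v ≤ j)

PEdge : ∀ {n} → Digraph n → Fin n → Fin n → Set
PEdge D u v =
  u ≢ v × (Arc D u v ⊎ Arc D v u ⊎ ∃[ w ] (Arc D u w × Arc D v w))

-- P(D) has an induced subgraph on {v} ∪ {leaf k | k : Fin (suc j)}
-- isomorphic to K_{1,j+1} with center v.
InducedStar : ∀ {n} → Digraph n → (j : ℕ) → Fin n → (Fin (suc j) → Fin n) → Set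
InducedStar D j v leaf =
  Injective _≡_ _≡_ leaf
  × (∀ k → leaf k ≢ v)
  × (∀ k → PEdge D v (leaf k))
  × (∀ k l → ¬ PEdge D (leaf k) (leaf l))

-- V(H) as a duplicate-free list
starVerts : ∀ {n} (j : ℕ) → Fin n → (Fin (suc j) → Fin n) → List (Fin n)
starVerts j v leaf = v ∷ map leaf (Data.List.allFin (suc j))

inNbrsIn : ∀ {n} → Digraph n → Fin n → List (Fin n) → ℕ
inNbrsIn D v xs = countL (λ u → arc D u v) xs

{-# OPTIONS --safe #-}

-- A leaf pointing to v and another leaf pointing to v would share the
-- out-neighbour v, hence be adjacent in P(D); so at most one leaf is an
-- in-neighbour of v.  If none were, each leaf ℓ would be adjacent to v through
-- an out-neighbour w_ℓ of v with w_ℓ = ℓ or ℓ → w_ℓ.  Two leaves with the same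
-- w would again be adjacent in P(D), so ℓ ↦ w_ℓ is injective and v would have
-- j + 1 out-neighbours.  Acyclicity rules out the loop v → v, so the count over
-- V(H) is exactly the count over the leaves.
module Submission where

open import Defs
open import Data.Nat using (ℕ; zero; suc; _+_; _≤_; z≤n; s≤s)
open import Data.Nat.Properties using (m≤n+m; ≤-trans; 1+n≰n; module ≤-Reasoning)
open import Data.Fin using (Fin; zero; suc; punchIn; punchOut)
open import Data.Fin.Properties
  using (_≟_; any?; injective⇒≤; 0≢1+n; suc-injective; punchIn-injective; punchInᵢ≢i;
         punchOut-injective; punchIn-punchOut)
open import Data.Bool using (Bool; true; false; T; T?)
open import Data.List using (allFin; tabulate)
open import Data.List.Properties using (map-tabulate; map-∘)
open import Data.Nat.ListAction using () renaming (sum to lsum)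
open import Data.Product using (_,_; proj₁; proj₂; _×_; ∃-syntax)
open import Data.Sum using (_⊎_; inj₁; inj₂)
open import Function using (_∘_; id)
open import Function.Definitions using (Injective)
open import Relation.Nullary using (¬_; yes; no; contradiction)
open import Relation.Binary.PropositionalEquality
open import Relation.Binary.Construct.Closure.Transitive using ([_])

private
  variable
    k n : ℕ

b2n-T : ∀ {b} → T b → b2n b ≡ 1
b2n-T {true} _ = refl

b2n-¬T : ∀ {b} → ¬ T b → b2n b ≡ 0
b2n-¬T {true} ¬t = contradiction _ ¬t
b2n-¬T {false} _ = refl

count : (Fin n → Bool) → ℕ
count q = lsum (tabulate (b2n ∘ q))

countL-allFin : (q : Fin n → Bool) → countL q (allFin n) ≡ count q
countL-allFin q = cong lsum (map-tabulate id (b2n ∘ q))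

count-none : (q : Fin n → Bool) → (∀ x → ¬ T (q x)) → count q ≡ 0
count-none {zero} q _ = refl
count-none {suc n} q none = cong₂ _+_ (b2n-¬T (none zero)) (count-none (q ∘ suc) (none ∘ suc))

count-unique : (q : Fin n → Bool) (x : Fin n) → T (q x) → (∀ y → T (q y) → y ≡ x) →
               count q ≡ 1
count-unique q zero qx uniq =
  cong₂ _+_ (b2n-T qx) (count-none (q ∘ suc) λ y qy → 0≢1+n (sym (uniq (suc y) qy)))
count-unique q (suc x) qx uniq =
  cong₂ _+_ (b2n-¬T λ q0 → 0≢1+n (uniq zero q0))
            (count-unique (q ∘ suc) x qx λ y qy → suc-injective (uniq (suc y) qy))

injection⇒≤count : (q : Fin n → Bool) (f : Fin k → Fin n) → Injective _≡_ _≡_ f →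
                   (∀ x → T (q (f x))) → k ≤ count q

injection-avoiding-zero⇒≤count :
  (q : Fin (suc n) → Bool) (f : Fin k → Fin (suc n)) → Injective _≡_ _≡_ f →
  (∀ x → zero ≢ f x) → (∀ x → T (q (f x))) → k ≤ count (q ∘ suc)
injection-avoiding-zero⇒≤count q f f-inj 0∉f qf =
  injection⇒≤count (q ∘ suc) (punchOut ∘ 0∉f)
    (λ e → f-inj (punchOut-injective (0∉f _) (0∉f _) e))
    (λ x → subst (T ∘ q) (sym (punchIn-punchOut (0∉f x))) (qf x))

injection⇒≤count {n = zero} q f f-inj _ = injective⇒≤ f-inj
injection⇒≤count {n = suc n} {k = zero} q f _ _ = z≤n
injection⇒≤count {n = suc n} {k = suc k} q f f-inj qf with any? (λ x → f x ≟ zero)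
... | no 0∉f =
  ≤-trans (injection-avoiding-zero⇒≤count q f f-inj (λ x e → 0∉f (x , sym e)) qf)
          (m≤n+m _ (b2n (q zero)))
... | yes (x₀ , fx₀≡0) = begin
  suc k                          ≤⟨ s≤s (injection-avoiding-zero⇒≤count q (f ∘ punchIn x₀)
                                          (punchIn-injective x₀ _ _ ∘ f-inj)
                                          (λ y e → punchInᵢ≢i x₀ y (f-inj (sym (trans fx₀≡0 e))))
                                          (qf ∘ punchIn x₀)) ⟩
  1 + count (q ∘ suc)            ≡⟨ cong (_+ count (q ∘ suc)) (sym (b2n-T (subst (T ∘ q) fx₀≡0 (qf x₀)))) ⟩
  b2n (q zero) + count (q ∘ suc) ∎
  where open ≤-Reasoning

Acyclic⇒¬loop : {D : Digraph n} → Acyclic D → ∀ v → ¬ Arc D v v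
Acyclic⇒¬loop acyclic v loop = acyclic v [ loop ]

ClosedOutNbr : Digraph n → Fin n → Fin n → Set
ClosedOutNbr D u w = u ≡ w ⊎ Arc D u w

module _ {D : Digraph n} where

  closedOutNbrs-meet⇒PEdge : ∀ {u u′ w} → u ≢ u′ →
    ClosedOutNbr D u w → ClosedOutNbr D u′ w → PEdge D u u′
  closedOutNbrs-meet⇒PEdge u≢u′ (inj₁ refl) (inj₁ refl) = contradiction refl u≢u′
  closedOutNbrs-meet⇒PEdge u≢u′ (inj₁ refl) (inj₂ u′→u) = u≢u′ , inj₂ (inj₁ u′→u)
  closedOutNbrs-meet⇒PEdge u≢u′ (inj₂ u→u′) (inj₁ refl) = u≢u′ , inj₁ u→u′
  closedOutNbrs-meet⇒PEdge u≢u′ (inj₂ u→w) (inj₂ u′→w) =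
    u≢u′ , inj₂ (inj₂ (_ , u→w , u′→w))

  PEdge⇒outNbr∈closedOutNbr : ∀ {v u} → PEdge D v u → ¬ Arc D u v →
    ∃[ w ] Arc D v w × ClosedOutNbr D u w
  PEdge⇒outNbr∈closedOutNbr (_ , inj₁ v→u) _ = _ , v→u , inj₁ refl
  PEdge⇒outNbr∈closedOutNbr (_ , inj₂ (inj₁ u→v)) ¬u→v = contradiction u→v ¬u→v
  PEdge⇒outNbr∈closedOutNbr (_ , inj₂ (inj₂ (w , v→w , u→w))) _ = w , v→w , inj₂ u→w

module _ {j} {D : Digraph n} {v : Fin n} {leaf : Fin (suc j) → Fin n} where

  leaves-closedOutNbrs-disjoint : InducedStar D j v leaf → ∀ {k l w} →
    ClosedOutNbr D (leaf k) w → ClosedOutNbr D (leaf l) w → k ≡ l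
  leaves-closedOutNbrs-disjoint (leaf-inj , _ , _ , leaves≁) {k} {l} ck cl with k ≟ l
  ... | yes k≡l = k≡l
  ... | no k≢l = contradiction (closedOutNbrs-meet⇒PEdge {D = D} (k≢l ∘ leaf-inj) ck cl) (leaves≁ k l)

  inLeaf-unique : InducedStar D j v leaf → ∀ k l → Arc D (leaf k) v → Arc D (leaf l) v → k ≡ l
  inLeaf-unique star k l k→v l→v = leaves-closedOutNbrs-disjoint star (inj₂ k→v) (inj₂ l→v)

  inLeaf-exists : InducedStar D j v leaf → outdeg D v ≤ j → ∃[ k ] Arc D (leaf k) v
  inLeaf-exists star@(_ , _ , v~leaf , _) outdeg≤j with any? (λ k → T? (arc D (leaf k) v))
  ... | yes found = found
  ... | no none = contradiction (≤-trans j+1≤outdeg outdeg≤j) 1+n≰n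
    where
      reach : ∀ k → ∃[ w ] Arc D v w × ClosedOutNbr D (leaf k) w
      reach k = PEdge⇒outNbr∈closedOutNbr (v~leaf k) (λ k→v → none (k , k→v))

      w : Fin (suc j) → Fin n
      w = proj₁ ∘ reach

      w-inj : Injective _≡_ _≡_ w
      w-inj {k} {l} wk≡wl = leaves-closedOutNbrs-disjoint star (proj₂ (proj₂ (reach k)))
        (subst (ClosedOutNbr D (leaf l)) (sym wk≡wl) (proj₂ (proj₂ (reach l))))

      j+1≤outdeg : suc j ≤ outdeg D v
      j+1≤outdeg = subst (suc j ≤_) (sym (countL-allFin (arc D v)))
        (injection⇒≤count (arc D v) w w-inj (proj₁ ∘ proj₂ ∘ reach))

lemma3p3 : (i j : ℕ) → 1 ≤ i → 1 ≤ j → {n : ℕ} → (D : Digraph n) →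
    IsIJDigraph i j D →
    (v : Fin n) → (leaf : Fin (suc j) → Fin n) →
    InducedStar D j v leaf →
    inNbrsIn D v (starVerts j v leaf) ≡ 1
lemma3p3 i j _ _ D (acyclic , _ , outdeg≤j) v leaf star
  with inLeaf-exists star (outdeg≤j v)
... | l , l→v = begin
  inNbrsIn D v (starVerts j v leaf)
    ≡⟨ cong₂ _+_ (b2n-¬T (Acyclic⇒¬loop acyclic v)) (cong lsum (sym (map-∘ (allFin (suc j))))) ⟩
  countL inLeaf (allFin (suc j))
    ≡⟨ countL-allFin inLeaf ⟩
  count inLeaf
    ≡⟨ count-unique inLeaf l l→v (λ l′ l′→v → inLeaf-unique star l′ l l′→v l→v) ⟩
  1 ∎
  where
    open ≡-Reasoning
    inLeaf : Fin (suc j) → Bool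
    inLeaf k = arc D (leaf k) v
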